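{- Let $\lambda=(\lambda_1\ge\dots\ge\lambda_m>0)$ be an integer partition and $\mathcal{O}\subset T([2])$ the finite order ideal with $x_1^{a}x_2^{b}\in\mathcal{O}$ iff $a<m$ and $b<\lambda_{a+1}$. Write $\mathrm{ind}_{\mathcal{O}}(a,b)=\mathrm{ind}_{\mathcal{O}}(x_1^ax_2^b)$. For a number $b$ put \[P_1(y;b)=\sum_{i=0}^\infty (i+b)y^i=\frac{b-(b-1)y}{(1-y)^2},\qquad P_2(y_1,y_2;b)=\sum_{i_1,i_2\ge 0}(i_1+i_2+b)y_1^{i_1}y_2^{i_2}=\frac{b-(b-1)(y_1+y_2)+(b-2)y_1y_2}{(1-y_1)^2(1-y_2)^2}.\] Then \[ \begin{aligned} \mathrm{Ind}_{\mathcal{O}}(y_1,y_2)={}& y_1^m y_2^{\lambda_1}P_2\big(y_1,y_2;\mathrm{ind}_{\mathcal{O}}(m,\lambda_1)\big)+\sum_{j=0}^{m-1}y_1^jy_2^{\lambda_1}P_1\big(y_2;\mathrm{ind}_{\mathcal{O}}(j,\lambda_1)\big)\\ &+\sum_{i=0}^{\lambda_1-1}y_1^my_2^{i}P_1\big(y_1;\mathrm{ind}_{\mathcal{O}}(m,i)\big)+\sum_{\substack{x_1^{a_1}x_2^{a_2}\notin\mathcal{O}\\ a_1<m,\ a_2<\lambda_1}}\mathrm{ind}_{\mathcal{O}}(a_1,a_2)\,y_1^{a_1}y_2^{a_2}. \end{aligned} \] In particular, $\mathrm{Ind}_{\mathcal{O}}$ is a rational function whose denominator divides $(1-y_1)^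2(1-y_2)^2$.
   Context: $T([2])=\{x_1^ax_2^b:a,b\in\mathbb{N}\}$; $T([2])_k$ is the set of power products of total degree $k$. An order ideal is a set of power products closed under division. For an order ideal $\mathcal{O}$: $\partial\mathcal{O}=(T([2])_1\cdot\mathcal{O})\setminus\mathcal{O}$, $\overline{\partial\mathcal{O}}=\partial\mathcal{O}\cup\mathcal{O}$, $\overline{\partial^0\mathcal{O}}=\mathcal{O}$, $\partial^k\mathcal{O}=\partial(\overline{\partial^{k-1}\mathcal{O}})$, $\overline{\partial^k\mathcal{O}}=\partial^k\mathcal{O}\cup\overline{\partial^{k-1}\mathcal{O}}$; the index $\mathrm{ind}_{\mathcal{O}}(t)$ is the least $k$ with $t\in\overline{\partial^k\mathcal{O}}$. The generating function is $\mathrm{Ind}_{\mathcal{O}}(y_1,y_2)=\sum_{\alpha\in\mathbb{N}^2}\mathrm{ind}_{\mathcal{O}}(x^\alpha)y^\alpha$. -}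

module Defs where

open import Data.Nat using (ℕ; zero; suc; _+_; _∸_; _≤_; _<_; _≤?_; _<?_)
open import Data.Integer as ℤ using (ℤ; +_; _-_)
open import Data.Bool using (Bool; true; false; if_then_else_; _∧_; not)
open import Data.List using (List; []; _∷_; length)
open import Data.Product using (Σ; _×_; _,_)
open import Data.Sum using (_⊎_)
open import Relation.Nullary using (¬_; Dec; does)
open import Relation.Nullary.Decidable using (_×-dec_)
open import Relation.Binary.PropositionalEquality using (_≡_)

-- Power products x₁^a x₂^b are identified with pairs (a , b) ∈ ℕ².
-- A set of power products is a predicate on ℕ².

PPSet : Set₁
PPSet = ℕ → ℕ → Set

-- T([2])₁ · S : the set of x_i · t with t ∈ S.
T1· : PPSet → PPSet
T1· S a b = (Σ ℕ λ a' → a ≡ suc a' × S a' b) ⊎ (Σ ℕ λ b' → b ≡ suc b' × S a b')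

∂ : PPSet → PPSet
∂ S a b = T1· S a b × ¬ S a b

closure : PPSet → ℕ → PPSet
closure O zero    = O
closure O (suc k) = λ a b → ∂ (closure O k) a b ⊎ closure O k a b

IsIndex : PPSet → ℕ → ℕ → ℕ → Set
IsIndex O a b k = closure O k a b × (∀ j → closure O j a b → k ≤ j)

-- nth λ i = λ_{i+1}  (0 beyond the length)
nth : List ℕ → ℕ → ℕ
nth []       _       = 0
nth (x ∷ xs) zero    = x
nth (x ∷ xs) (suc i) = nth xs i

OPart : List ℕ → PPSet
OPart λs a b = a < length λs × b < nth λs a

OPart? : (λs : List ℕ) → (a b : ℕ) → Dec (OPart λs a b)
OPart? λs a b = (a <? length λs) ×-dec (b <? nth λs (a))

-- Formal power series in y₁, y₂ with coefficients in ℕ: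
-- F i j is the coefficient of y₁^i y₂^j.

PS : Set
PS = ℕ → ℕ → ℕ

_≋_ : PS → PS → Set
F ≋ G = ∀ i j → F i j ≡ G i j

infix 4 _≋_
infixl 6 _⊕_

_⊕_ : PS → PS → PS
(F ⊕ G) i j = F i j + G i j

𝟘 : PS
𝟘 _ _ = 0

const : ℕ → PS
const c zero zero = c
const c _    _    = 0

shift : ℕ → ℕ → PS → PS
shift p q F i j = if does (p ≤? i) ∧ does (q ≤? j) then F (i ∸ p) (j ∸ q) else 0

Σ< : ℕ → (ℕ → PS) → PS
Σ< zero    F = 𝟘
Σ< (suc n) F = Σ< n F ⊕ F n

P1y₁ : ℕ → PS
P1y₁ b i zero    = i + b
P1y₁ b i (suc _) = 0

P1y₂ : ℕ → PS
P1y₂ b zero    j = j + b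
P1y₂ b (suc _) j = 0

P2 : ℕ → PS
P2 b i₁ i₂ = i₁ + i₂ + b

IndSeries : (ℕ → ℕ → ℕ) → PS
IndSeries ind = ind

RHS : (l₁ : ℕ) (ls : List ℕ) (ind : ℕ → ℕ → ℕ) → PS
RHS l₁ ls ind =
  shift m l₁ (P2 (ind m l₁))
  ⊕ Σ< m (λ j → shift j l₁ (P1y₂ (ind j l₁)))
  ⊕ Σ< l₁ (λ i → shift m i (P1y₁ (ind m i)))
  ⊕ Σ< m (λ a₁ → Σ< l₁ (λ a₂ →
       if not (does (OPart? (l₁ ∷ ls) a₁ a₂))
       then shift a₁ a₂ (const (ind a₁ a₂))
       else 𝟘))
  where m = length (l₁ ∷ ls)

PSℤ : Set
PSℤ = ℕ → ℕ → ℤ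

toℤ : PS → PSℤ
toℤ F i j = + F i j

mul1-y₁ : PSℤ → PSℤ
mul1-y₁ F zero    j = F zero j
mul1-y₁ F (suc i) j = F (suc i) j - F i j

mul1-y₂ : PSℤ → PSℤ
mul1-y₂ F i zero    = F i zero
mul1-y₂ F i (suc j) = F i (suc j) - F i j

clearDen : PSℤ → PSℤ
clearDen F = mul1-y₁ (mul1-y₁ (mul1-y₂ (mul1-y₂ F)))

IsPolynomial : PSℤ → Set
IsPolynomial F = Σ ℕ λ N → ∀ i j → N ≤ i ⊎ N ≤ j → F i j ≡ + 0

module Submission where

-- Write m for the number of parts of λ and l₁ for its largest part.
-- No monomial of the order ideal O lies in a column a ≥ m or in a row b ≥ l₁.
-- For an arbitrary set O, crossing a line free of O increases the index by
-- exactly one; hence ind(i,j) = (i - m) + ind(m,j) for i ≥ m and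
-- ind(i,j) = (j - l₁) + ind(i,l₁) for j ≥ l₁.  The plane splits into four
-- regions (i < m or not, j < l₁ or not); in each region exactly one of the four
-- blocks of the right-hand side is nonzero, and its coefficient is the index by
-- the two linearity formulas.  For the rational form, linear growth in i (resp. j)
-- with constant slope is killed by the second difference (1 - y₁)² (resp. (1 - y₂)²).

open import Defs
open import Data.Nat using (ℕ; zero; suc; _+_; _∸_; _≤_; _<_; _≥_; z≤n; s≤s; _<?_; _≟_; _≤ᵇ_)
open import Data.Nat.Properties
open import Data.List using (List; []; _∷_; length)
open import Data.List.Relation.Unary.All using (All)
open import Data.List.Relation.Unary.Linked using (Linked; _∷_)
open import Data.Product using (Σ; _×_; _,_)
open import Data.Sum using (_⊎_; inj₁; inj₂)
open import Data.Bool using (true; false; not; if_then_else_)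
open import Data.Empty using (⊥-elim)
open import Relation.Nullary using (¬_; Dec; yes; no; does)
open import Relation.Nullary.Reflects using (ofʸ; ofⁿ)
open import Relation.Nullary.Decidable using (_×-dec_; _⊎-dec_; map′; ¬?)
open import Relation.Binary.PropositionalEquality
  using (_≡_; _≢_; refl; sym; trans; cong; module ≡-Reasoning)
open import Data.Integer as ℤ using (ℤ; +_)
open import Data.Integer.Tactic.RingSolver using (solve-∀)

module IndexTheory (O : PPSet) (O? : ∀ a b → Dec (O a b)) where

  T1·? : (S : PPSet) → (∀ a b → Dec (S a b)) → ∀ a b → Dec (T1· S a b)
  T1·? S S? a b = below₁ a ⊎-dec below₂ b
    where
    below₁ : ∀ a → Dec (Σ ℕ λ a' → a ≡ suc a' × S a' b)
    below₁ zero    = no λ { (_ , () , _) }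
    below₁ (suc a) = map′ (λ s → a , refl , s) (λ { (_ , refl , s) → s }) (S? a b)
    below₂ : ∀ b → Dec (Σ ℕ λ b' → b ≡ suc b' × S a b')
    below₂ zero    = no λ { (_ , () , _) }
    below₂ (suc b) = map′ (λ s → b , refl , s) (λ { (_ , refl , s) → s }) (S? a b)

  closure? : ∀ k a b → Dec (closure O k a b)
  closure? zero    a b = O? a b
  closure? (suc k) a b =
    (T1·? _ (closure? k) a b ×-dec ¬? (closure? k a b)) ⊎-dec closure? k a b

  closure-grows : ∀ k a b → T1· (closure O k) a b → closure O (suc k) a b
  closure-grows k a b t with closure? k a b
  ... | yes c = inj₂ c
  ... | no ¬c = inj₁ (t , ¬c)

  retreat₁ : ∀ a → (∀ b → ¬ O (suc a) b) →
             ∀ k b → closure O (suc k) (suc a) b → closure O k a b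
  retreat₁ a free zero    b (inj₂ c) = ⊥-elim (free b c)
  retreat₁ a free (suc k) b (inj₂ c) = inj₂ (retreat₁ a free k b c)
  retreat₁ a free k       b (inj₁ (inj₁ (_ , refl , c) , _)) = c
  retreat₁ a free zero    b (inj₁ (inj₂ (b' , refl , c) , _)) = ⊥-elim (free b' c)
  retreat₁ a free (suc k) b (inj₁ (inj₂ (b' , refl , c) , _)) =
    closure-grows k a b (inj₂ (b' , refl , retreat₁ a free k b' c))

  retreat₂ : ∀ b → (∀ a → ¬ O a (suc b)) →
             ∀ k a → closure O (suc k) a (suc b) → closure O k a b
  retreat₂ b free zero    a (inj₂ c) = ⊥-elim (free a c)
  retreat₂ b free (suc k) a (inj₂ c) = inj₂ (retreat₂ b free k a c)
  retreat₂ b free k       a (inj₁ (inj₂ (_ , refl , c) , _)) = c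
  retreat₂ b free zero    a (inj₁ (inj₁ (a' , refl , c) , _)) = ⊥-elim (free a' c)
  retreat₂ b free (suc k) a (inj₁ (inj₁ (a' , refl , c) , _)) =
    closure-grows k a b (inj₁ (a' , refl , retreat₂ b free k a' c))

  index-step₁ : ∀ a b {i i'} → (∀ b → ¬ O (suc a) b) →
                IsIndex O a b i → IsIndex O (suc a) b i' → i' ≡ suc i
  index-step₁ a b {i} {zero}  free _ (c' , _) = ⊥-elim (free b c')
  index-step₁ a b {i} {suc k} free (c , least) (c' , least') = ≤-antisym
    (least' (suc i) (closure-grows i (suc a) b (inj₁ (a , refl , c))))
    (s≤s (least k (retreat₁ a free k b c')))

  index-step₂ : ∀ a b {i i'} → (∀ a → ¬ O a (suc b)) →
                IsIndex O a b i → IsIndex O a (suc b) i' → i' ≡ suc i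
  index-step₂ a b {i} {zero}  free _ (c' , _) = ⊥-elim (free a c')
  index-step₂ a b {i} {suc k} free (c , least) (c' , least') = ≤-antisym
    (least' (suc i) (closure-grows i a (suc b) (inj₂ (b , refl , c))))
    (s≤s (least k (retreat₂ b free k a c')))

  index-on-O : ∀ {a b k} → O a b → IsIndex O a b k → k ≡ 0
  index-on-O o (_ , least) = n≤0⇒n≡0 (least 0 o)

  module Linear (ind : ℕ → ℕ → ℕ) (isIndex : ∀ a b → IsIndex O a b (ind a b)) where

    step₁ : ∀ c → (∀ a b → c ≤ a → ¬ O a b) → ∀ a b → c ≤ a → ind (suc a) b ≡ suc (ind a b)
    step₁ c free a b c≤a =
      index-step₁ a b (λ b' → free (suc a) b' (m≤n⇒m≤1+n c≤a)) (isIndex a b) (isIndex (suc a) b)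

    step₂ : ∀ r → (∀ a b → r ≤ b → ¬ O a b) → ∀ a b → r ≤ b → ind a (suc b) ≡ suc (ind a b)
    step₂ r free a b r≤b =
      index-step₂ a b (λ a' → free a' (suc b) (m≤n⇒m≤1+n r≤b)) (isIndex a b) (isIndex a (suc b))

    linear₁ : ∀ c → (∀ a b → c ≤ a → ¬ O a b) → ∀ i j → c ≤ i → ind i j ≡ (i ∸ c) + ind c j
    linear₁ c free i j c≤i = trans (cong (λ x → ind x j) (sym (m∸n+n≡m c≤i))) (go (i ∸ c))
      where
      go : ∀ d → ind (d + c) j ≡ d + ind c j
      go zero    = refl
      go (suc d) = trans (step₁ c free (d + c) j (m≤n+m c d)) (cong suc (go d))

    linear₂ : ∀ r → (∀ a b → r ≤ b → ¬ O a b) → ∀ i j → r ≤ j → ind i j ≡ (j ∸ r) + ind i r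
    linear₂ r free i j r≤j = trans (cong (ind i) (sym (m∸n+n≡m r≤j))) (go (j ∸ r))
      where
      go : ∀ d → ind i (d + r) ≡ d + ind i r
      go zero    = refl
      go (suc d) = trans (step₂ r free i (d + r) (m≤n+m r d)) (cong suc (go d))

nth-bounded : ∀ l ls → Linked _≥_ (l ∷ ls) → ∀ a → nth (l ∷ ls) a ≤ l
nth-bounded l ls       _         zero    = ≤-refl
nth-bounded l []       _         (suc a) = z≤n
nth-bounded l (x ∷ xs) (l≥x ∷ lk) (suc a) = ≤-trans (nth-bounded x xs lk a) l≥x

OPart-columns : ∀ λs a b → length λs ≤ a → ¬ OPart λs a b
OPart-columns λs a b m≤a (a<m , _) = <⇒≱ a<m m≤a

OPart-rows : ∀ l ls → Linked _≥_ (l ∷ ls) → ∀ a b → l ≤ b → ¬ OPart (l ∷ ls) a b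
OPart-rows l ls lk a b l≤b (_ , b<λ) = <⇒≱ (≤-trans b<λ (nth-bounded l ls lk a)) l≤b

shift-inside : ∀ p q F i j → p ≤ i → q ≤ j → shift p q F i j ≡ F (i ∸ p) (j ∸ q)
shift-inside p q F i j p≤i q≤j
  with p ≤ᵇ i | ≤ᵇ-reflects-≤ p i | q ≤ᵇ j | ≤ᵇ-reflects-≤ q j
... | true  | _       | true  | _       = refl
... | true  | _       | false | ofⁿ q≰j = ⊥-elim (q≰j q≤j)
... | false | ofⁿ p≰i | _     | _       = ⊥-elim (p≰i p≤i)

shift-vanishes : ∀ p q F i j → (p ≤ i → q ≤ j → F (i ∸ p) (j ∸ q) ≡ 0) → shift p q F i j ≡ 0
shift-vanishes p q F i j h
  with p ≤ᵇ i | ≤ᵇ-reflects-≤ p i | q ≤ᵇ j | ≤ᵇ-reflects-≤ q j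
... | true  | ofʸ p≤i | true  | ofʸ q≤j = h p≤i q≤j
... | true  | _       | false | _       = refl
... | false | _       | _     | _       = refl

shift-left : ∀ p q F i j → i < p → shift p q F i j ≡ 0
shift-left p q F i j i<p = shift-vanishes p q F i j (λ p≤i _ → ⊥-elim (<⇒≱ i<p p≤i))

shift-below : ∀ p q F i j → j < q → shift p q F i j ≡ 0
shift-below p q F i j j<q = shift-vanishes p q F i j (λ _ q≤j → ⊥-elim (<⇒≱ j<q q≤j))

OnColumn0 : PS → Set
OnColumn0 F = ∀ x y → 0 < x → F x y ≡ 0

OnRow0 : PS → Set
OnRow0 F = ∀ x y → 0 < y → F x y ≡ 0

shift-off-column : ∀ p q F i j → OnColumn0 F → p ≢ i → shift p q F i j ≡ 0
shift-off-column p q F i j col p≢i =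
  shift-vanishes p q F i j (λ p≤i _ → col (i ∸ p) (j ∸ q) (m<n⇒0<n∸m (≤∧≢⇒< p≤i p≢i)))

shift-off-row : ∀ p q F i j → OnRow0 F → q ≢ j → shift p q F i j ≡ 0
shift-off-row p q F i j row q≢j =
  shift-vanishes p q F i j (λ _ q≤j → row (i ∸ p) (j ∸ q) (m<n⇒0<n∸m (≤∧≢⇒< q≤j q≢j)))

P1y₂-on-column0 : ∀ c → OnColumn0 (P1y₂ c)
P1y₂-on-column0 c (suc x) y _ = refl

P1y₁-on-row0 : ∀ c → OnRow0 (P1y₁ c)
P1y₁-on-row0 c x (suc y) _ = refl

const-on-column0 : ∀ c → OnColumn0 (const c)
const-on-column0 c (suc x) y _ = refl

const-on-row0 : ∀ c → OnRow0 (const c)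
const-on-row0 c zero    (suc y) _ = refl
const-on-row0 c (suc x) (suc y) _ = refl

Σ<-vanishes : ∀ n (F : ℕ → PS) i j → (∀ k → k < n → F k i j ≡ 0) → Σ< n F i j ≡ 0
Σ<-vanishes zero    F i j h = refl
Σ<-vanishes (suc n) F i j h
  rewrite Σ<-vanishes n F i j (λ k k<n → h k (m≤n⇒m≤1+n k<n)) | h n ≤-refl = refl

Σ<-single : ∀ n (F : ℕ → PS) i j t → t < n → (∀ k → k < n → k ≢ t → F k i j ≡ 0) →
            Σ< n F i j ≡ F t i j
Σ<-single (suc n) F i j t t<1+n h with t ≟ n
... | yes refl
  rewrite Σ<-vanishes n F i j (λ k k<n → h k (m≤n⇒m≤1+n k<n) (<⇒≢ k<n)) = refl
... | no t≢n
  rewrite Σ<-single n F i j t (≤∧≢⇒< (≤-pred t<1+n) t≢n) (λ k k<n → h k (m≤n⇒m≤1+n k<n))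
        | h n ≤-refl (λ n≡t → t≢n (sym n≡t)) = +-identityʳ _

keepOutside : {P : Set} → Dec P → PS → PS
keepOutside d F = if not (does d) then F else 𝟘

keepOutside-vanishes : ∀ {P : Set} (d : Dec P) F i j → F i j ≡ 0 → keepOutside d F i j ≡ 0
keepOutside-vanishes (yes _) F i j _  = refl
keepOutside-vanishes (no _)  F i j h = h

keepOutside-diagonal : ∀ {P : Set} (d : Dec P) i j c → (P → c ≡ 0) →
                       keepOutside d (shift i j (const c)) i j ≡ c
keepOutside-diagonal (yes p) i j c on-P = sym (on-P p)
keepOutside-diagonal (no _)  i j c _
  rewrite shift-inside i j (const c) i j ≤-refl ≤-refl | n∸n≡0 i | n∸n≡0 j = refl

module Blocks (l₁ : ℕ) (ls : List ℕ) (ind : ℕ → ℕ → ℕ) where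

  m : ℕ
  m = length (l₁ ∷ ls)

  corner : PS
  corner = shift m l₁ (P2 (ind m l₁))

  columnTerm : ℕ → PS
  columnTerm k = shift k l₁ (P1y₂ (ind k l₁))

  rowTerm : ℕ → PS
  rowTerm k = shift m k (P1y₁ (ind m k))

  boxTerm : ℕ → ℕ → PS
  boxTerm a₁ a₂ = keepOutside (OPart? (l₁ ∷ ls) a₁ a₂) (shift a₁ a₂ (const (ind a₁ a₂)))

  box : PS
  box = Σ< m (λ a₁ → Σ< l₁ (boxTerm a₁))

  corner-outside : ∀ i j → i < m ⊎ j < l₁ → corner i j ≡ 0
  corner-outside i j (inj₁ i<m)  = shift-left m l₁ (P2 (ind m l₁)) i j i<m
  corner-outside i j (inj₂ j<l₁) = shift-below m l₁ (P2 (ind m l₁)) i j j<l₁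

  corner-inside : ∀ i j → m ≤ i → l₁ ≤ j → corner i j ≡ (i ∸ m) + (j ∸ l₁) + ind m l₁
  corner-inside i j = shift-inside m l₁ (P2 (ind m l₁)) i j

  columns-outside : ∀ i j → m ≤ i ⊎ j < l₁ → Σ< m columnTerm i j ≡ 0
  columns-outside i j (inj₁ m≤i) = Σ<-vanishes m columnTerm i j λ k k<m →
    shift-off-column k l₁ (P1y₂ (ind k l₁)) i j (P1y₂-on-column0 _) (<⇒≢ (<-≤-trans k<m m≤i))
  columns-outside i j (inj₂ j<l₁) = Σ<-vanishes m columnTerm i j λ k _ →
    shift-below k l₁ (P1y₂ (ind k l₁)) i j j<l₁

  columns-inside : ∀ i j → i < m → l₁ ≤ j → Σ< m columnTerm i j ≡ (j ∸ l₁) + ind i l₁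
  columns-inside i j i<m l₁≤j = begin
    Σ< m columnTerm i j                   ≡⟨ Σ<-single m columnTerm i j i i<m (λ k _ k≢i →
                                              shift-off-column k l₁ (P1y₂ (ind k l₁)) i j (P1y₂-on-column0 _) k≢i) ⟩
    columnTerm i i j                      ≡⟨ shift-inside i l₁ (P1y₂ (ind i l₁)) i j ≤-refl l₁≤j ⟩
    P1y₂ (ind i l₁) (i ∸ i) (j ∸ l₁)      ≡⟨ cong (λ x → P1y₂ (ind i l₁) x (j ∸ l₁)) (n∸n≡0 i) ⟩
    (j ∸ l₁) + ind i l₁                   ∎
    where open ≡-Reasoning

  rows-outside : ∀ i j → i < m ⊎ l₁ ≤ j → Σ< l₁ rowTerm i j ≡ 0
  rows-outside i j (inj₁ i<m) = Σ<-vanishes l₁ rowTerm i j λ k _ →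
    shift-left m k (P1y₁ (ind m k)) i j i<m
  rows-outside i j (inj₂ l₁≤j) = Σ<-vanishes l₁ rowTerm i j λ k k<l₁ →
    shift-off-row m k (P1y₁ (ind m k)) i j (P1y₁-on-row0 _) (<⇒≢ (<-≤-trans k<l₁ l₁≤j))

  rows-inside : ∀ i j → m ≤ i → j < l₁ → Σ< l₁ rowTerm i j ≡ (i ∸ m) + ind m j
  rows-inside i j m≤i j<l₁ = begin
    Σ< l₁ rowTerm i j                     ≡⟨ Σ<-single l₁ rowTerm i j j j<l₁ (λ k _ k≢j →
                                              shift-off-row m k (P1y₁ (ind m k)) i j (P1y₁-on-row0 _) k≢j) ⟩
    rowTerm j i j                         ≡⟨ shift-inside m j (P1y₁ (ind m j)) i j m≤i ≤-refl ⟩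
    P1y₁ (ind m j) (i ∸ m) (j ∸ j)        ≡⟨ cong (P1y₁ (ind m j) (i ∸ m)) (n∸n≡0 j) ⟩
    (i ∸ m) + ind m j                     ∎
    where open ≡-Reasoning

  boxTerm-elsewhere : ∀ a₁ a₂ i j → a₁ ≢ i ⊎ a₂ ≢ j → boxTerm a₁ a₂ i j ≡ 0
  boxTerm-elsewhere a₁ a₂ i j ne = keepOutside-vanishes (OPart? (l₁ ∷ ls) a₁ a₂) (shift a₁ a₂ (const (ind a₁ a₂))) i j (off ne)
    where
    off : a₁ ≢ i ⊎ a₂ ≢ j → shift a₁ a₂ (const (ind a₁ a₂)) i j ≡ 0
    off (inj₁ a₁≢i) = shift-off-column a₁ a₂ (const (ind a₁ a₂)) i j (const-on-column0 _) a₁≢i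
    off (inj₂ a₂≢j) = shift-off-row a₁ a₂ (const (ind a₁ a₂)) i j (const-on-row0 _) a₂≢j

  box-outside : ∀ i j → m ≤ i ⊎ l₁ ≤ j → box i j ≡ 0
  box-outside i j out = Σ<-vanishes m (λ a₁ → Σ< l₁ (boxTerm a₁)) i j λ a₁ a₁<m → Σ<-vanishes l₁ (boxTerm a₁) i j λ a₂ a₂<l₁ →
    boxTerm-elsewhere a₁ a₂ i j (different a₁<m a₂<l₁ out)
    where
    different : ∀ {a₁ a₂} → a₁ < m → a₂ < l₁ → m ≤ i ⊎ l₁ ≤ j → a₁ ≢ i ⊎ a₂ ≢ j
    different a₁<m _ (inj₁ m≤i)  = inj₁ (<⇒≢ (<-≤-trans a₁<m m≤i))
    different _ a₂<l₁ (inj₂ l₁≤j) = inj₂ (<⇒≢ (<-≤-trans a₂<l₁ l₁≤j))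

  box-inside : ∀ i j → i < m → j < l₁ → (OPart (l₁ ∷ ls) i j → ind i j ≡ 0) → box i j ≡ ind i j
  box-inside i j i<m j<l₁ on-O = begin
    box i j               ≡⟨ Σ<-single m (λ a₁ → Σ< l₁ (boxTerm a₁)) i j i i<m (λ k _ k≢i →
                               Σ<-vanishes l₁ (boxTerm k) i j λ a₂ _ → boxTerm-elsewhere k a₂ i j (inj₁ k≢i)) ⟩
    Σ< l₁ (boxTerm i) i j ≡⟨ Σ<-single l₁ (boxTerm i) i j j j<l₁ (λ k _ k≢j →
                               boxTerm-elsewhere i k i j (inj₂ k≢j)) ⟩
    boxTerm i j i j       ≡⟨ keepOutside-diagonal (OPart? (l₁ ∷ ls) i j) i j (ind i j) on-O ⟩
    ind i j               ∎
    where open ≡-Reasoning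

Δ : (ℕ → ℤ) → ℕ → ℤ
Δ E zero    = E zero
Δ E (suc j) = E (suc j) ℤ.- E j

LinearIn₁ : ℕ → PSℤ → (ℕ → ℤ) → Set
LinearIn₁ N H E = ∀ k → N ≤ k → ∀ j → H (suc k) j ≡ H k j ℤ.+ E j

LinearIn₂ : ℕ → PSℤ → ℤ → Set
LinearIn₂ N H e = ∀ k → N ≤ k → ∀ i → H i (suc k) ≡ H i k ℤ.+ e

second-difference : ∀ x y z e → y ≡ x ℤ.+ e → z ≡ y ℤ.+ e → (z ℤ.- y) ℤ.- (y ℤ.- x) ≡ + 0
second-difference x _ _ e refl refl = cancel x e
  where
  cancel : ∀ x e → (((x ℤ.+ e) ℤ.+ e) ℤ.- (x ℤ.+ e)) ℤ.- ((x ℤ.+ e) ℤ.- x) ≡ + 0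
  cancel = solve-∀

mul1-y₂-linear₁ : ∀ N H E → LinearIn₁ N H E → LinearIn₁ N (mul1-y₂ H) (Δ E)
mul1-y₂-linear₁ N H E lin k N≤k zero    = lin k N≤k zero
mul1-y₂-linear₁ N H E lin k N≤k (suc j)
  rewrite lin k N≤k (suc j) | lin k N≤k j = regroup (H k (suc j)) (H k j) (E (suc j)) (E j)
  where
  regroup : ∀ a b c d → (a ℤ.+ c) ℤ.- (b ℤ.+ d) ≡ (a ℤ.- b) ℤ.+ (c ℤ.- d)
  regroup = solve-∀

mul1-y₁-row-vanishes : ∀ H j → (∀ i → H i j ≡ + 0) → ∀ i → mul1-y₁ H i j ≡ + 0
mul1-y₁-row-vanishes H j h zero = h zero
mul1-y₁-row-vanishes H j h (suc i) rewrite h i | h (suc i) = refl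

clearDen-polynomial : ∀ N H E e → LinearIn₁ N H E → LinearIn₂ N H e → IsPolynomial (clearDen H)
clearDen-polynomial N H E e lin₁ lin₂ = suc (suc N) , vanish
  where
  G : PSℤ
  G = mul1-y₂ (mul1-y₂ H)

  G-linear₁ : LinearIn₁ N G (Δ (Δ E))
  G-linear₁ = mul1-y₂-linear₁ N (mul1-y₂ H) (Δ E) (mul1-y₂-linear₁ N H E lin₁)

  G-row-vanishes : ∀ k → N ≤ k → ∀ i → G i (suc (suc k)) ≡ + 0
  G-row-vanishes k N≤k i = second-difference (H i k) (H i (suc k)) (H i (suc (suc k))) e
    (lin₂ k N≤k i) (lin₂ (suc k) (m≤n⇒m≤1+n N≤k) i)

  vanish : ∀ i j → suc (suc N) ≤ i ⊎ suc (suc N) ≤ j → clearDen H i j ≡ + 0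
  vanish (suc (suc k)) j (inj₁ (s≤s (s≤s N≤k))) =
    second-difference (G k j) (G (suc k) j) (G (suc (suc k)) j) (Δ (Δ E) j)
      (G-linear₁ k N≤k j) (G-linear₁ (suc k) (m≤n⇒m≤1+n N≤k) j)
  vanish (suc zero)    j (inj₁ (s≤s ()))
  vanish i (suc (suc k)) (inj₂ (s≤s (s≤s N≤k))) =
    mul1-y₁-row-vanishes _ _ (mul1-y₁-row-vanishes G _ (G-row-vanishes k N≤k)) i

module PartitionIndex (l₁ : ℕ) (ls : List ℕ) (decreasing : Linked _≥_ (l₁ ∷ ls))
                      (ind : ℕ → ℕ → ℕ) (isIndex : ∀ a b → IsIndex (OPart (l₁ ∷ ls)) a b (ind a b)) where

  open Blocks l₁ ls ind
  open IndexTheory (OPart (l₁ ∷ ls)) (OPart? (l₁ ∷ ls))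
  open Linear ind isIndex

  columns-free : ∀ a b → m ≤ a → ¬ OPart (l₁ ∷ ls) a b
  columns-free = OPart-columns (l₁ ∷ ls)

  rows-free : ∀ a b → l₁ ≤ b → ¬ OPart (l₁ ∷ ls) a b
  rows-free = OPart-rows l₁ ls decreasing

  index-far : ∀ i j → m ≤ i → l₁ ≤ j → ind i j ≡ (i ∸ m) + (j ∸ l₁) + ind m l₁
  index-far i j m≤i l₁≤j = begin
    ind i j                               ≡⟨ linear₁ m columns-free i j m≤i ⟩
    (i ∸ m) + ind m j                     ≡⟨ cong (λ x → (i ∸ m) + x) (linear₂ l₁ rows-free m j l₁≤j) ⟩
    (i ∸ m) + ((j ∸ l₁) + ind m l₁)       ≡⟨ +-assoc (i ∸ m) (j ∸ l₁) (ind m l₁) ⟨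
    (i ∸ m) + (j ∸ l₁) + ind m l₁         ∎
    where open ≡-Reasoning

  -- Each coefficient of the right-hand side equals the index: in each of the four
  -- regions exactly one block contributes.
  coefficient : ∀ i j → ind i j ≡ RHS l₁ ls ind i j
  coefficient i j with i <? m | j <? l₁
  ... | yes i<m | yes j<l₁
    rewrite corner-outside i j (inj₁ i<m) | columns-outside i j (inj₂ j<l₁)
          | rows-outside i j (inj₁ i<m)
          | box-inside i j i<m j<l₁ (λ o → index-on-O o (isIndex i j)) = refl
  ... | yes i<m | no j≮l₁
    rewrite corner-outside i j (inj₁ i<m) | columns-inside i j i<m (≮⇒≥ j≮l₁)
          | rows-outside i j (inj₁ i<m) | box-outside i j (inj₂ (≮⇒≥ j≮l₁))
          | +-identityʳ ((j ∸ l₁) + ind i l₁) | +-identityʳ ((j ∸ l₁) + ind i l₁)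
          = linear₂ l₁ rows-free i j (≮⇒≥ j≮l₁)
  ... | no i≮m | yes j<l₁
    rewrite corner-outside i j (inj₂ j<l₁) | columns-outside i j (inj₂ j<l₁)
          | rows-inside i j (≮⇒≥ i≮m) j<l₁ | box-outside i j (inj₁ (≮⇒≥ i≮m))
          | +-identityʳ ((i ∸ m) + ind m j)
          = linear₁ m columns-free i j (≮⇒≥ i≮m)
  ... | no i≮m | no j≮l₁
    rewrite corner-inside i j (≮⇒≥ i≮m) (≮⇒≥ j≮l₁) | columns-outside i j (inj₁ (≮⇒≥ i≮m))
          | rows-outside i j (inj₂ (≮⇒≥ j≮l₁)) | box-outside i j (inj₁ (≮⇒≥ i≮m))
          | +-identityʳ ((i ∸ m) + (j ∸ l₁) + ind m l₁)
          | +-identityʳ ((i ∸ m) + (j ∸ l₁) + ind m l₁)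
          | +-identityʳ ((i ∸ m) + (j ∸ l₁) + ind m l₁)
          = index-far i j (≮⇒≥ i≮m) (≮⇒≥ j≮l₁)

  -- Beyond column m + l₁ and row m + l₁ the index grows with slope one.
  polynomial-numerator : IsPolynomial (clearDen (toℤ ind))
  polynomial-numerator = clearDen-polynomial (m + l₁) (toℤ ind) (λ _ → + 1) (+ 1)
    (λ k N≤k j → cong +_ (trans (step₁ m columns-free k j (≤-trans (m≤m+n m l₁) N≤k)) (+-comm 1 _)))
    (λ k N≤k i → cong +_ (trans (step₂ l₁ rows-free i k (≤-trans (m≤n+m l₁ m) N≤k)) (+-comm 1 _)))

mainTheorem3 : (l₁ : ℕ) (ls : List ℕ) → Linked _≥_ (l₁ ∷ ls) → All (0 <_) (l₁ ∷ ls)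
    → (ind : ℕ → ℕ → ℕ) → (∀ a b → IsIndex (OPart (l₁ ∷ ls)) a b (ind a b))
    → (IndSeries ind ≋ RHS l₁ ls ind) × IsPolynomial (clearDen (toℤ (IndSeries ind)))
mainTheorem3 l₁ ls decreasing _ ind isIndex = coefficient , polynomial-numerator
  where open PartitionIndex l₁ ls decreasing ind isIndex
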